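{- Let $d:\omega\to\omega$ be a total function. There is a total computable function $s$ such that for every partial function $V$ on $\omega$ whose values are pairs $(i,n)$ of natural numbers, and every $d$-$\mathrm{DNR}^V$ function $g$, there is a total function $r\leq_T g$ such that for every $x$, $r(x)<d(s(x))$, and whenever $V_0(x)$ is defined, $r(x)\neq V_0(x)$.
   Context: For $V$ as in the statement, $V_0(x)=i$ whenever $V(x)=(i,n)$ for some $n$ (and $V_0(x)$ is undefined otherwise). A total function $g$ is $d$-$\mathrm{DNR}^V$ if $g(e)<d(e)$ for all $e$ and $g(e)\neq\varphi^V_e(e)$ whenever $\varphi^V_e(e)\downarrow$. -}

module Defs where

open import Data.Nat using (ℕ; zero; suc; _+_; _<_)
open import Data.Fin using (Fin; toℕ)
open import Data.Vec using (Vec; []; _∷_; lookup)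
open import Data.Product using (Σ; _×_; _,_; ∃)
open import Data.Empty using (⊥)
open import Relation.Binary.PropositionalEquality using (_≡_)
open import Relation.Nullary using (¬_)

-- Cantor pairing  ⟨a , b⟩ = (a+b)(a+b+1)/2 + b

tri : ℕ → ℕ
tri zero    = zero
tri (suc k) = suc k + tri k

pair : ℕ → ℕ → ℕ
pair a b = tri (a + b) + b

-- Oracle partial recursive functions (Kleene's μ-recursive functions
-- with an extra unary oracle-query basic function).

data PR : ℕ → Set where
  Z    : ∀ {n} → PR n
  S    : PR 1
  P    : ∀ {n} → Fin n → PR n
  Q    : PR 1
  comp : ∀ {k n} → PR k → Vec (PR n) k → PR n
  prim : ∀ {n} → PR n → PR (suc (suc n)) → PR (suc n)
  mu   : ∀ {n} → PR (suc n) → PR n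

-- An oracle is the graph of a (possibly partial) function ℕ ⇀ ℕ.
Oracle : Set₁
Oracle = ℕ → ℕ → Set

-- Big-step semantics: Eval O p xs v  means  p^O(xs) ↓ = v.
mutual
  data Eval (O : Oracle) : ∀ {n} → PR n → Vec ℕ n → ℕ → Set where
    eZ    : ∀ {n} {xs : Vec ℕ n} → Eval O Z xs 0
    eS    : ∀ {x} → Eval O S (x ∷ []) (suc x)
    eP    : ∀ {n} {i : Fin n} {xs} → Eval O (P i) xs (lookup xs i)
    eQ    : ∀ {x y} → O x y → Eval O Q (x ∷ []) y
    eComp : ∀ {k n} {f : PR k} {gs : Vec (PR n) k} {xs ys v} →
            EvalVec O gs xs ys → Eval O f ys v → Eval O (comp f gs) xs v
    ePrim0 : ∀ {n} {f : PR n} {h xs v} →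
             Eval O f xs v → Eval O (prim f h) (0 ∷ xs) v
    ePrimS : ∀ {n} {f : PR n} {h xs m u v} →
             Eval O (prim f h) (m ∷ xs) u → Eval O h (m ∷ u ∷ xs) v →
             Eval O (prim f h) (suc m ∷ xs) v
    eMu   : ∀ {n} {f : PR (suc n)} {xs y} →
            Eval O f (y ∷ xs) 0 →
            (∀ z → z < y → ∃ λ w → Eval O f (z ∷ xs) (suc w)) →
            Eval O (mu f) xs y

  data EvalVec (O : Oracle) {n} : ∀ {k} → Vec (PR n) k → Vec ℕ n → Vec ℕ k → Set where
    []  : ∀ {xs} → EvalVec O [] xs []
    _∷_ : ∀ {k} {g : PR n} {gs : Vec (PR n) k} {xs y ys} →
          Eval O g xs y → EvalVec O gs xs ys → EvalVec O (g ∷ gs) xs (y ∷ ys)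

-- Gödel numbering (injective for each fixed arity).

mutual
  code : ∀ {n} → PR n → ℕ
  code Z          = pair 0 0
  code S          = pair 1 0
  code (P i)      = pair 2 (toℕ i)
  code Q          = pair 3 0
  code (comp f gs) = pair 4 (pair (code f) (codeVec gs))
  code (prim f h) = pair 5 (pair (code f) (code h))
  code (mu f)     = pair 6 (code f)

  codeVec : ∀ {n k} → Vec (PR n) k → ℕ
  codeVec []       = 0
  codeVec (g ∷ gs) = suc (pair (code g) (codeVec gs))

Φ : Oracle → ℕ → ℕ → ℕ → Set
Φ O e x v = Σ (PR 1) λ p → code p ≡ e × Eval O p (x ∷ []) v

emptyOracle : Oracle
emptyOracle _ _ = ⊥

graph : (ℕ → ℕ) → Oracle
graph g x y = g x ≡ y

Computable : (ℕ → ℕ) → Set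
Computable f = Σ (PR 1) λ p → ∀ x → Eval emptyOracle p (x ∷ []) (f x)

_≤T_ : (ℕ → ℕ) → (ℕ → ℕ) → Set
r ≤T g = Σ (PR 1) λ p → ∀ x → Eval (graph g) p (x ∷ []) (r x)

PairPartial : Set₁
PairPartial = ℕ → ℕ × ℕ → Set

IsPartialFunction : PairPartial → Set
IsPartialFunction V = ∀ x a b → V x a → V x b → a ≡ b

pairOracle : PairPartial → Oracle
pairOracle V x y = Σ ℕ λ i → Σ ℕ λ n → V x (i , n) × y ≡ pair i n

V₀ : PairPartial → ℕ → ℕ → Set
V₀ V x i = Σ ℕ λ n → V x (i , n)

DNR : (ℕ → ℕ) → PairPartial → (ℕ → ℕ) → Set
DNR d V g = (∀ e → g e < d e) × (∀ e v → Φ (pairOracle V) e e v → ¬ (g e ≡ v))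

-- Let s(x) be the code of the program that ignores its input, asks the oracle
-- for V(x) = ⟨i , n⟩ and outputs i. Then φ^V_{s(x)}(s(x)) = V₀(x), so r = g ∘ s
-- avoids V₀ because g is DNR^V, is bounded by d ∘ s, and is computable from g
-- because s is computable: codes are built by Cantor pairing, which is
-- primitive recursive.
module Submission where

open import Defs
open import Data.Nat using (ℕ; zero; suc; _+_; _∸_; _≤_; _<_; pred; z≤n; s≤s)
open import Data.Nat.Properties
  using (+-mono-≤; +-monoʳ-≤; +-comm; +-suc; ≤-trans; m≤m+n; m≤n+m; m+n∸m≡n; m+n∸n≡m;
         +-∸-assoc; m≤n⇒m∸n≡0; pred[m∸n]≡m∸[1+n])
open import Data.Fin using (toℕ; #_)
open import Data.Vec using (Vec; []; _∷_)
open import Data.Product using (Σ; _×_; _,_; ∃)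
open import Relation.Binary.PropositionalEquality using (_≡_; refl; subst; trans; cong)
open import Relation.Nullary using (¬_)

private
  variable
    O : Oracle
    n : ℕ
    xs : Vec ℕ n

sucᴾ : PR n → PR n
sucᴾ a = comp S (a ∷ [])

eval-sucᴾ : ∀ {a u} → Eval O a xs u → Eval O (sucᴾ a) xs (suc u)
eval-sucᴾ ea = eComp (ea ∷ []) eS

const : ℕ → PR n
const zero    = Z
const (suc k) = sucᴾ (const k)

eval-const : ∀ k → Eval O (const k) xs k
eval-const zero    = eZ
eval-const (suc k) = eval-sucᴾ (eval-const k)

add : PR 2
add = prim (P (# 0)) (sucᴾ (P (# 1)))

eval-add : ∀ m k → Eval O add (m ∷ k ∷ []) (m + k)
eval-add zero    k = ePrim0 eP
eval-add (suc m) k = ePrimS (eval-add m k) (eval-sucᴾ eP)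

triangle : PR 1
triangle = prim Z (comp add (sucᴾ (P (# 0)) ∷ P (# 1) ∷ []))

eval-triangle : ∀ m → Eval O triangle (m ∷ []) (tri m)
eval-triangle zero    = ePrim0 eZ
eval-triangle (suc m) =
  ePrimS (eval-triangle m) (eComp (eval-sucᴾ eP ∷ eP ∷ []) (eval-add (suc m) (tri m)))

pairing : PR 2
pairing = comp add (comp triangle (add ∷ []) ∷ P (# 1) ∷ [])

eval-pairing : ∀ a b → Eval O pairing (a ∷ b ∷ []) (pair a b)
eval-pairing a b =
  eComp (eComp (eval-add a b ∷ []) (eval-triangle (a + b)) ∷ eP ∷ []) (eval-add (tri (a + b)) b)

pairᴾ : PR n → PR n → PR n
pairᴾ a b = comp pairing (a ∷ b ∷ [])

eval-pairᴾ : ∀ {a b u w} → Eval O a xs u → Eval O b xs w → Eval O (pairᴾ a b) xs (pair u w)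
eval-pairᴾ {u = u} {w} ea eb = eComp (ea ∷ eb ∷ []) (eval-pairing u w)

predecessor : PR 1
predecessor = prim Z (P (# 0))

eval-predecessor : ∀ m → Eval O predecessor (m ∷ []) (pred m)
eval-predecessor zero    = ePrim0 eZ
eval-predecessor (suc m) = ePrimS (eval-predecessor m) eP

-- monus takes the subtrahend first, the recursion being on it.
monus : PR 2
monus = prim (P (# 0)) (comp predecessor (P (# 1) ∷ []))

eval-monus : ∀ b a → Eval O monus (b ∷ a ∷ []) (a ∸ b)
eval-monus zero    a = ePrim0 eP
eval-monus (suc b) a = subst (Eval _ monus _) (pred[m∸n]≡m∸[1+n] a b)
  (ePrimS (eval-monus b a) (eComp (eP ∷ []) (eval-predecessor (a ∸ b))))

tri-mono-≤ : ∀ {a b} → a ≤ b → tri a ≤ tri b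
tri-mono-≤ z≤n     = z≤n
tri-mono-≤ (s≤s p) = +-mono-≤ (s≤s p) (tri-mono-≤ p)

pair<tri[1+sum] : ∀ i k → pair i k < tri (suc (i + k))
pair<tri[1+sum] i k = subst (pair i k <_) (+-comm (tri (i + k)) (suc (i + k)))
  (subst (_≤ tri (i + k) + suc (i + k)) (+-suc (tri (i + k)) k)
    (+-monoʳ-≤ (tri (i + k)) (s≤s (m≤n+m k i))))

-- exceedsᴾ (w , v) is zero exactly when v < tri (1 + w).
exceedsᴾ : PR 2
exceedsᴾ = comp monus (comp triangle (sucᴾ (P (# 0)) ∷ []) ∷ sucᴾ (P (# 1)) ∷ [])

eval-exceedsᴾ : ∀ w v → Eval O exceedsᴾ (w ∷ v ∷ []) (suc v ∸ tri (suc w))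
eval-exceedsᴾ w v =
  eComp (eComp (eval-sucᴾ eP ∷ []) (eval-triangle (suc w)) ∷ eval-sucᴾ eP ∷ [])
        (eval-monus (tri (suc w)) (suc v))

componentSum : PR 1
componentSum = mu exceedsᴾ

eval-componentSum : ∀ i k → Eval O componentSum (pair i k ∷ []) (i + k)
eval-componentSum i k =
  eMu (subst (Eval _ exceedsᴾ _) (m≤n⇒m∸n≡0 (pair<tri[1+sum] i k))
             (eval-exceedsᴾ (i + k) (pair i k)))
      below
  where
  below : ∀ z → z < i + k → ∃ λ u → Eval _ exceedsᴾ (z ∷ pair i k ∷ []) (suc u)
  below z z<sum = pair i k ∸ tri (suc z) ,
    subst (Eval _ exceedsᴾ _)
          (+-∸-assoc 1 (≤-trans (tri-mono-≤ z<sum) (m≤m+n (tri (i + k)) k)))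
          (eval-exceedsᴾ z (pair i k))

-- With w = i + k read off by componentSum, i = w ∸ (pair i k ∸ tri w).
-- Opaque, since normalising its (astronomically large, unary) code would stall
-- type checking of index below.
opaque
  first : PR 1
  first = comp monus (comp monus (comp triangle (componentSum ∷ []) ∷ P (# 0) ∷ [])
                     ∷ componentSum ∷ [])

opaque
  unfolding first

  eval-first : ∀ i k → Eval O first (pair i k ∷ []) i
  eval-first i k =
    subst (Eval _ first _) (trans (cong (i + k ∸_) (m+n∸m≡n (tri (i + k)) k)) (m+n∸n≡m i k))
      (eComp (eComp (eComp (eval-componentSum i k ∷ []) (eval-triangle (i + k)) ∷ eP ∷ [])
                    (eval-monus (tri (i + k)) (pair i k))
              ∷ eval-componentSum i k ∷ [])
             (eval-monus (pair i k ∸ tri (i + k)) (i + k)))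

compCodeᴾ : PR n → PR n → PR n
compCodeᴾ f gs = pairᴾ (const 4) (pairᴾ f gs)

eval-compCodeᴾ : ∀ {f gs u w} → Eval O f xs u → Eval O gs xs w →
                 Eval O (compCodeᴾ f gs) xs (pair 4 (pair u w))
eval-compCodeᴾ ef egs = eval-pairᴾ (eval-const 4) (eval-pairᴾ ef egs)

consCodeᴾ : PR n → PR n → PR n
consCodeᴾ g gs = sucᴾ (pairᴾ g gs)

eval-consCodeᴾ : ∀ {g gs u w} → Eval O g xs u → Eval O gs xs w →
                 Eval O (consCodeᴾ g gs) xs (suc (pair u w))
eval-consCodeᴾ eg egs = eval-sucᴾ (eval-pairᴾ eg egs)

mutual
  ⌜_⌝ : ∀ {k} → PR k → PR n
  ⌜ Z ⌝         = pairᴾ (const 0) (const 0)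
  ⌜ S ⌝         = pairᴾ (const 1) (const 0)
  ⌜ P i ⌝       = pairᴾ (const 2) (const (toℕ i))
  ⌜ Q ⌝         = pairᴾ (const 3) (const 0)
  ⌜ comp f gs ⌝ = compCodeᴾ ⌜ f ⌝ ⌜ gs ⌝ᵛ
  ⌜ prim f h ⌝  = pairᴾ (const 5) (pairᴾ ⌜ f ⌝ ⌜ h ⌝)
  ⌜ mu f ⌝      = pairᴾ (const 6) ⌜ f ⌝

  ⌜_⌝ᵛ : ∀ {k m} → Vec (PR m) k → PR n
  ⌜ [] ⌝ᵛ     = const 0
  ⌜ g ∷ gs ⌝ᵛ = consCodeᴾ ⌜ g ⌝ ⌜ gs ⌝ᵛ

mutual
  eval-quote : ∀ {k} (p : PR k) → Eval O ⌜ p ⌝ xs (code p)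
  eval-quote Z           = eval-pairᴾ (eval-const 0) (eval-const 0)
  eval-quote S           = eval-pairᴾ (eval-const 1) (eval-const 0)
  eval-quote (P i)       = eval-pairᴾ (eval-const 2) (eval-const (toℕ i))
  eval-quote Q           = eval-pairᴾ (eval-const 3) (eval-const 0)
  eval-quote (comp f gs) = eval-compCodeᴾ (eval-quote f) (eval-quoteᵛ gs)
  eval-quote (prim f h)  = eval-pairᴾ (eval-const 5) (eval-pairᴾ (eval-quote f) (eval-quote h))
  eval-quote (mu f)      = eval-pairᴾ (eval-const 6) (eval-quote f)

  eval-quoteᵛ : ∀ {k m} (gs : Vec (PR m) k) → Eval O ⌜ gs ⌝ᵛ xs (codeVec gs)
  eval-quoteᵛ []       = eval-const 0
  eval-quoteᵛ (g ∷ gs) = eval-consCodeᴾ (eval-quote g) (eval-quoteᵛ gs)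

codeConst : PR 1
codeConst = prim (⌜ Z {1} ⌝) (compCodeᴾ ⌜ S ⌝ (consCodeᴾ (P (# 1)) (const 0)))

eval-codeConst : ∀ x → Eval O codeConst (x ∷ []) (code (const {1} x))
eval-codeConst zero    = ePrim0 (eval-quote (Z {1}))
eval-codeConst (suc x) =
  ePrimS (eval-codeConst x) (eval-compCodeᴾ (eval-quote S) (eval-consCodeᴾ eP (eval-const 0)))

queryFirst : ℕ → PR 1
queryFirst x = comp first (comp Q (const x ∷ []) ∷ [])

eval-queryFirst : ∀ {V x i k} → V x (i , k) → ∀ y → Eval (pairOracle V) (queryFirst x) (y ∷ []) i
eval-queryFirst {i = i} {k} vx y =
  eComp (eComp (eval-const _ ∷ []) (eQ (i , k , vx , refl)) ∷ []) (eval-first i k)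

index : ℕ → ℕ
index x = code (queryFirst x)

indexᴾ : PR 1
indexᴾ = compCodeᴾ ⌜ first ⌝ (consCodeᴾ (compCodeᴾ ⌜ Q ⌝ (consCodeᴾ codeConst (const 0))) (const 0))

eval-indexᴾ : ∀ x → Eval O indexᴾ (x ∷ []) (index x)
eval-indexᴾ x =
  eval-compCodeᴾ (eval-quote first)
    (eval-consCodeᴾ (eval-compCodeᴾ (eval-quote Q) (eval-consCodeᴾ (eval-codeConst x) (eval-const 0)))
                    (eval-const 0))

mainTheorem5 : (d : ℕ → ℕ) →
    Σ (ℕ → ℕ) λ s → Computable s ×
      ((V : PairPartial) → IsPartialFunction V →
       (g : ℕ → ℕ) → DNR d V g →
       Σ (ℕ → ℕ) λ r → (r ≤T g) × (∀ x → r x < d (s x)) ×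
         (∀ x i → V₀ V x i → ¬ (r x ≡ i)))
mainTheorem5 d = index , (indexᴾ , eval-indexᴾ) , λ V _ g (g<d , g-avoids) →
  let r : ℕ → ℕ
      r x = g (index x)
      r≤Tg : r ≤T g
      r≤Tg = comp Q (indexᴾ ∷ []) , λ x → eComp (eval-indexᴾ x ∷ []) (eQ refl)
      diagonal : ∀ x i → V₀ V x i → Φ (pairOracle V) (index x) (index x) i
      diagonal x i (_ , vx) = queryFirst x , refl , eval-queryFirst vx (index x)
  in r , r≤Tg , (λ x → g<d (index x)) , λ x i v₀ → g-avoids (index x) i (diagonal x i v₀)
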